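{- Let $G$ be a finite simple graph and let $i$ and $j$ be positive integers. Then $G$ is an $\langle i,j\rangle$ competition graph if and only if (i) $G\not\cong K_2$, (ii) if $j=1$ then $G$ is not a nontrivial complete graph (i.e. not $K_n$ with $n\ge 2$), and (iii) $\mathbf{C}(G,i,j)\neq\emptyset$.
   Context: All digraphs are finite, without loops and without parallel arcs; all graphs are finite and simple. The competition graph of a digraph $D$ has vertex set $V(D)$ and an edge $uv$ ($u\ne v$) iff $u$ and $v$ have a common out-neighbor in $D$. For positive integers $i,j$, an $\langle i,j\rangle$ digraph is a loopless digraph in which every vertex has indegree at most $i$ and outdegree at most $j$ (not necessarily acyclic). An $\langle i,j\rangle$ competition graph is the competition graph of some $\langle i,j\rangle$ digraph. Cliques are identified with their vertex sets; an edge clique cover of $G$ is a collection of cliques covering all edges of $G$. $\mathbf{C}(G,i,j)$ denotes the set of edge clique covers $\mathcal{C}=\{C_1,\ldots,C_p\}$ of $G$ such that $|C_t|\le i$ for every $t$, each vertex of $G$ lies in at most $j$ cliques of $\mathcal{C}$, and $p\le |V(G)|$. -}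

module Defs where

open import Data.Nat using (ℕ; zero; suc; _≤_)
open import Data.Fin using (Fin; zero; suc; _≟_)
open import Data.Bool using (Bool; true; false)
open import Data.Product using (Σ; ∃; _×_; _,_)
open import Relation.Nullary using (yes; no; ¬_)
open import Relation.Binary.PropositionalEquality using (_≡_; _≢_; refl; sym)
open import Function.Bundles using (_⇔_; _↔_; Inverse)

count : ∀ {n} → (Fin n → Bool) → ℕ
count {zero}  p = 0
count {suc n} p with p zero
... | true  = suc (count (λ x → p (suc x)))
... | false = count (λ x → p (suc x))

record Graph : Set where
  field
    n      : ℕ
    adj    : Fin n → Fin n → Bool
    adj-sym    : ∀ u v → adj u v ≡ adj v u
    adj-irrefl : ∀ u → adj u u ≡ false
open Graph public

kadj : ∀ {m} → Fin m → Fin m → Bool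
kadj u v with u ≟ v
... | yes _ = false
... | no  _ = true

kadj-sym : ∀ {m} (u v : Fin m) → kadj u v ≡ kadj v u
kadj-sym u v with u ≟ v | v ≟ u
... | yes _ | yes _ = refl
... | yes p | no ¬q = Data.Empty.⊥-elim (¬q (sym p)) where import Data.Empty
... | no ¬p | yes q = Data.Empty.⊥-elim (¬p (sym q)) where import Data.Empty
... | no _  | no _  = refl

kadj-irrefl : ∀ {m} (u : Fin m) → kadj u u ≡ false
kadj-irrefl u with u ≟ u
... | yes _ = refl
... | no ¬p = Data.Empty.⊥-elim (¬p refl) where import Data.Empty

K : ℕ → Graph
K m = record { n = m ; adj = kadj ; adj-sym = kadj-sym ; adj-irrefl = kadj-irrefl }

_≅_ : Graph → Graph → Set
G ≅ H = Σ (Fin (n G) ↔ Fin (n H)) λ f →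
          ∀ u v → adj G u v ≡ adj H (Inverse.to f u) (Inverse.to f v)

NontrivialComplete : Graph → Set
NontrivialComplete G = Σ ℕ λ m → (2 ≤ m) × (G ≅ K m)

record Digraph (n : ℕ) : Set where
  field
    arc      : Fin n → Fin n → Bool
    loopless : ∀ u → arc u u ≡ false
open Digraph public

indeg : ∀ {n} → Digraph n → Fin n → ℕ
indeg D v = count (λ u → arc D u v)

outdeg : ∀ {n} → Digraph n → Fin n → ℕ
outdeg D u = count (λ v → arc D u v)

IsIJDigraph : ∀ {n} → ℕ → ℕ → Digraph n → Set
IsIJDigraph i j D = (∀ v → indeg D v ≤ i) × (∀ v → outdeg D v ≤ j)

IsCompetitionGraphOf : (G : Graph) → Digraph (n G) → Set
IsCompetitionGraphOf G D =
  ∀ u v → (adj G u v ≡ true) ⇔ ((u ≢ v) × ∃ λ w → (arc D u w ≡ true) × (arc D v w ≡ true))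

IsIJCompetitionGraph : ℕ → ℕ → Graph → Set
IsIJCompetitionGraph i j G =
  Σ (Digraph (n G)) λ D → IsIJDigraph i j D × IsCompetitionGraphOf G D

IsClique : (G : Graph) → (Fin (n G) → Bool) → Set
IsClique G S = ∀ u v → S u ≡ true → S v ≡ true → u ≢ v → adj G u v ≡ true

-- An element of C(G,i,j): a family C_1,…,C_p of cliques (indexed by Fin p)
record ECC (G : Graph) (i j : ℕ) : Set where
  field
    p       : ℕ
    cl      : Fin p → Fin (n G) → Bool
    cliques : ∀ t → IsClique G (cl t)
    covers  : ∀ u v → adj G u v ≡ true → ∃ λ t → (cl t u ≡ true) × (cl t v ≡ true)
    size≤i  : ∀ t → count (cl t) ≤ i
    deg≤j   : ∀ v → count (λ t → cl t v) ≤ j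
    p≤n     : p ≤ n G

-- An ⟨i,j⟩ digraph D covers the edges of its competition graph by the in-neighbourhoods of its
-- vertices: cliques of size ≤ i, every vertex lying in ≤ j of them. The two ends of an edge have a
-- common prey, a third vertex since D is loopless, so G ≇ K₂; and if j = 1 and G is complete, a
-- vertex a and its only prey w are adjacent, hence share a prey, which can only be w itself.
--
-- Conversely, take a cover in C(G,i,j). If one clique contains every vertex, G is complete, and it
-- is either edgeless or, since G ≇ K₂ and j ≥ 2, covered by K_n − a₀, K_n − a₁ and the edge a₀a₁.
-- Otherwise shrink the cliques while some member x of a clique C can be dropped without uncovering
-- an edge. Afterwards each such x has a private partner y ∈ C lying in no other clique through x;
-- these partners show that the complements of the cliques satisfy Hall's condition (with p ≤ n),
-- so they have distinct representatives f(C) ∉ C, and the arcs u → f(C) for u ∈ C form an ⟨i,j⟩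
-- digraph whose competition graph is G.

module Submission where

open import Defs
open import Data.Nat using (ℕ; _≤_)
open import Data.Product using (_×_)
open import Relation.Nullary using (¬_)
open import Relation.Binary.PropositionalEquality using (_≡_)
open import Function.Bundles using (_⇔_)

open import Data.Nat using (zero; suc; _<_; _+_; z≤n; s≤s; _≤?_)
open import Data.Nat.Properties
  using (m≤n⇒m≤1+n; +-suc; +-cancelˡ-≤; +-monoˡ-≤; +-mono-≤; +-mono-<-≤; +-mono-≤-<; ≤-refl; ≤-trans;
         <-≤-trans; ≤-pred; m<m+n; <⇒≱; ≰⇒>; n≮0; ≤∧≢⇒<; n≤0⇒n≡0; module ≤-Reasoning)
open import Data.Fin using (Fin; zero; suc; _≟_; toℕ; inject≤)
open import Data.Fin.Properties using (any?; all?; ¬∀⟶∃¬; suc-injective; 0≢1+n; toℕ-injective; toℕ<n)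
open import Data.Fin.Subset.Properties using (anySubset?)
open import Data.Vec using (lookup; tabulate)
open import Data.Vec.Properties using (lookup∘tabulate)
open import Data.Bool using (Bool; true; false; not; _∧_; _∨_; if_then_else_)
open import Data.Bool.Properties using (∧-conicalˡ; ∧-conicalʳ; ∧-identityʳ; ∧-zeroʳ; ¬-not; not-injective)
  renaming (_≟_ to _≟ᵇ_)
open import Data.Product using (Σ; ∃; _,_; proj₁; proj₂; uncurry)
open import Data.Sum using (_⊎_; inj₁; inj₂)
open import Data.Empty using (⊥-elim)
open import Function using (_∘_; id)
open import Function.Bundles using (mk⇔; Equivalence; Inverse)
open import Function.Construct.Identity using (↔-id)
open import Function.Definitions using (Injective)
open import Relation.Nullary using (Dec; yes; no; does; ¬?; map′)
open import Relation.Nullary.Decidable using (dec-true; dec-false; decidable-stable; _×-dec_; _→-dec_)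
open import Relation.Binary.PropositionalEquality
  using (_≢_; refl; sym; trans; cong; cong₂; subst; subst₂; module ≡-Reasoning)

private
  variable
    m p q : ℕ

-- Finite sets as boolean predicates

true≢false : true ≢ false
true≢false ()

∨-elim : ∀ {a b} → a ∨ b ≡ true → a ≡ true ⊎ b ≡ true
∨-elim {true}  _ = inj₁ refl
∨-elim {false} e = inj₂ e

∨-true-unless : ∀ {a b} → (a ≡ false → b ≡ true) → a ∨ b ≡ true
∨-true-unless {true}  _ = refl
∨-true-unless {false} h = h refl

_==_ : Fin m → Fin m → Bool
x == y = does (x ≟ y)

==-refl : (x : Fin m) → (x == x) ≡ true
==-refl x = dec-true (x ≟ x) refl

==⇒≡ : {x y : Fin m} → (x == y) ≡ true → x ≡ y
==⇒≡ {x = x} {y} e with x ≟ y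
... | yes x≡y = x≡y

≢⇒==false : {x y : Fin m} → x ≢ y → (x == y) ≡ false
≢⇒==false {x = x} {y} = dec-false (x ≟ y)

==false⇒≢ : {x y : Fin m} → (x == y) ≡ false → x ≢ y
==false⇒≢ {x = x} x=y≡false refl = true≢false (trans (sym (==-refl x)) x=y≡false)

_⊆_ : (Fin m → Bool) → (Fin m → Bool) → Set
P ⊆ Q = ∀ x → P x ≡ true → Q x ≡ true

infix 4 _⊆_
infixr 7 _∩_
infixr 6 _∪_ _∖_

_∩_ _∪_ _∖_ : (Fin m → Bool) → (Fin m → Bool) → Fin m → Bool
(P ∩ Q) x = P x ∧ Q x
(P ∪ Q) x = P x ∨ Q x
(P ∖ Q) x = P x ∧ not (Q x)

⁅_⁆ : Fin m → Fin m → Bool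
⁅ y ⁆ x = x == y

count-cong : {P Q : Fin m → Bool} → (∀ x → P x ≡ Q x) → count P ≡ count Q
count-cong {zero}  eq = refl
count-cong {suc m} {P} {Q} eq with P zero | Q zero | eq zero
... | true  | true  | refl = cong suc (count-cong (eq ∘ suc))
... | false | false | refl = count-cong (eq ∘ suc)

count-mono : {P Q : Fin m → Bool} → P ⊆ Q → count P ≤ count Q
count-mono {zero}  P⊆Q = z≤n
count-mono {suc m} {P} {Q} P⊆Q with P zero in p₀ | Q zero in q₀
... | true  | true  = s≤s (count-mono (P⊆Q ∘ suc))
... | true  | false = ⊥-elim (true≢false (trans (sym (P⊆Q zero p₀)) q₀))
... | false | true  = m≤n⇒m≤1+n (count-mono (P⊆Q ∘ suc))
... | false | false = count-mono (P⊆Q ∘ suc)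

count-full : {P : Fin m → Bool} → (∀ x → P x ≡ true) → count P ≡ m
count-full {zero}  full = refl
count-full {suc m} {P} full with P zero | full zero
... | true | refl = cong suc (count-full (full ∘ suc))

count-empty : {P : Fin m → Bool} → (∀ x → P x ≡ false) → count P ≡ 0
count-empty {zero}  empty = refl
count-empty {suc m} {P} empty with P zero | empty zero
... | false | refl = count-empty (empty ∘ suc)

count≤size : (P : Fin m → Bool) → count P ≤ m
count≤size {m} P =
  subst (count P ≤_) (count-full {m} {λ _ → true} λ _ → refl) (count-mono {m} {P} λ _ _ → refl)

count-split : (P Q : Fin m → Bool) → count P ≡ count (P ∩ Q) + count (P ∖ Q)
count-split {zero}  P Q = refl
count-split {suc m} P Q with P zero | Q zero
... | true  | true  = cong suc (count-split (P ∘ suc) (Q ∘ suc))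
... | true  | false = trans (cong suc (count-split (P ∘ suc) (Q ∘ suc))) (sym (+-suc _ _))
... | false | _     = count-split (P ∘ suc) (Q ∘ suc)

∈⇒0<count : (P : Fin m → Bool) (x : Fin m) → P x ≡ true → 0 < count P
∈⇒0<count P zero    px with P zero
... | true = s≤s z≤n
∈⇒0<count P (suc x) px with P zero
... | true  = s≤s z≤n
... | false = ∈⇒0<count (P ∘ suc) x px

0<count⇒∃ : (P : Fin m → Bool) → 0 < count P → ∃ λ x → P x ≡ true
0<count⇒∃ {suc m} P pos with P zero in p₀
... | true  = zero , p₀
... | false with 0<count⇒∃ (P ∘ suc) pos
...   | x , px = suc x , px

count-singleton : (y : Fin m) → count ⁅ y ⁆ ≡ 1
count-singleton {suc m} zero    = cong suc (count-empty {m} λ _ → refl)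
count-singleton {suc m} (suc y) = count-singleton y

count≤1+count∖⁅⁆ : (P : Fin m → Bool) (y : Fin m) → count P ≤ 1 + count (P ∖ ⁅ y ⁆)
count≤1+count∖⁅⁆ P y = begin
  count P                               ≡⟨ count-split P ⁅ y ⁆ ⟩
  count (P ∩ ⁅ y ⁆) + count (P ∖ ⁅ y ⁆) ≤⟨ +-monoˡ-≤ _ (count-mono λ x → ∧-conicalʳ (P x) _) ⟩
  count ⁅ y ⁆ + count (P ∖ ⁅ y ⁆)       ≡⟨ cong (_+ count (P ∖ ⁅ y ⁆)) (count-singleton y) ⟩
  1 + count (P ∖ ⁅ y ⁆)                 ∎
  where open ≤-Reasoning

2≤count⇒∃≢ : (P : Fin m → Bool) → 2 ≤ count P → (y : Fin m) → ∃ λ x → P x ≡ true × x ≢ y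
2≤count⇒∃≢ P 2≤P y with 0<count⇒∃ (P ∖ ⁅ y ⁆) (+-cancelˡ-≤ 1 _ _ (≤-trans 2≤P (count≤1+count∖⁅⁆ P y)))
... | x , x∈P∖y = x , ∧-conicalˡ (P x) _ x∈P∖y , ==false⇒≢ (not-injective (∧-conicalʳ (P x) _ x∈P∖y))

⊆⇒∩≗ : {P Q : Fin m → Bool} → P ⊆ Q → ∀ x → (Q ∩ P) x ≡ P x
⊆⇒∩≗ {P = P} {Q} P⊆Q x with P x in px
... | true  = trans (cong (_∧ true) (P⊆Q x px)) (∧-identityʳ _)
... | false = ∧-zeroʳ (Q x)

∖⊆ : (P Q : Fin m → Bool) → P ∖ Q ⊆ P
∖⊆ P Q x = ∧-conicalˡ (P x) _

∖-excludes : (P : Fin m → Bool) {Q : Fin m → Bool} {x : Fin m} → Q x ≡ true → (P ∖ Q) x ≡ false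
∖-excludes P {x = x} qx = trans (cong (λ b → P x ∧ not b) qx) (∧-zeroʳ (P x))

count-strict : {P Q : Fin m → Bool} → P ⊆ Q → (y : Fin m) → Q y ≡ true → P y ≡ false → count P < count Q
count-strict {P = P} {Q} P⊆Q y qy py = begin-strict
  count P                         ≡⟨ count-cong (⊆⇒∩≗ P⊆Q) ⟨
  count (Q ∩ P)                   <⟨ m<m+n _ (∈⇒0<count (Q ∖ P) y (cong₂ _∧_ qy (cong not py))) ⟩
  count (Q ∩ P) + count (Q ∖ P)   ≡⟨ count-split Q P ⟨
  count Q                         ∎
  where open ≤-Reasoning

count-∖< : (P Q : Fin m → Bool) {x : Fin m} → P x ≡ true → Q x ≡ true → count (P ∖ Q) < count P
count-∖< P Q {x} px qx = count-strict (∖⊆ P Q) x px (∖-excludes P {Q} qx)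

count-disjoint-∪ : {S T : Fin m → Bool} → (∀ x → T x ≡ true → S x ≡ false) →
  count (T ∪ S) ≡ count S + count T
count-disjoint-∪ {S = S} {T} disjoint =
  trans (count-split (T ∪ S) S) (cong₂ _+_ (count-cong ∩-part) (count-cong ∖-part))
  where
  ∩-part : ∀ x → ((T ∪ S) ∩ S) x ≡ S x
  ∩-part x with T x | S x
  ... | _     | false = ∧-zeroʳ _
  ... | true  | true  = refl
  ... | false | true  = refl
  ∖-part : ∀ x → ((T ∪ S) ∖ S) x ≡ T x
  ∖-part x with T x in tx | S x in sx
  ... | false | true  = refl
  ... | false | false = refl
  ... | true  | false = refl
  ... | true  | true  = ⊥-elim (true≢false (trans (sym sx) (disjoint x tx)))

count≤1⇒unique : (P : Fin m → Bool) → count P ≤ 1 → ∀ {x y} → P x ≡ true → P y ≡ true → x ≡ y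
count≤1⇒unique P P≤1 {x} {y} px py with x ≟ y
... | yes x≡y = x≡y
... | no  x≢y = ⊥-elim (<⇒≱ 1<P P≤1)
  where
  1<P : 1 < count P
  1<P = subst (_< count P) (count-singleton x)
    (count-strict (λ z z=x → subst (λ w → P w ≡ true) (sym (==⇒≡ z=x)) px) y py (≢⇒==false (x≢y ∘ sym)))

count-injection : ∀ {a b} (A : Fin a → Bool) (B : Fin b → Bool) (g : ∀ t → A t ≡ true → Fin b) →
  (∀ t at → B (g t at) ≡ true) → (∀ {t t'} at at' → g t at ≡ g t' at' → t ≡ t') → count A ≤ count B
count-injection {zero} A B g g∈B g-inj = z≤n
count-injection {suc a} A B g g∈B g-inj with A zero in a₀
... | false = count-injection (A ∘ suc) B (g ∘ suc) (g∈B ∘ suc) (λ at at' → suc-injective ∘ g-inj at at')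
... | true  = ≤-trans (s≤s rest) (count-∖< B ⁅ y ⁆ (g∈B zero a₀) (==-refl y))
  where
  y = g zero a₀
  g≢y : ∀ t at → (g (suc t) at == y) ≡ false
  g≢y t at = ≢⇒==false λ eq → 0≢1+n (g-inj a₀ at (sym eq))
  rest : count (A ∘ suc) ≤ count (B ∖ ⁅ y ⁆)
  rest = count-injection (A ∘ suc) (B ∖ ⁅ y ⁆) (g ∘ suc)
    (λ t at → cong₂ _∧_ (g∈B (suc t) at) (cong not (g≢y t at)))
    (λ at at' → suc-injective ∘ g-inj at at')

-- Hall's theorem

any : (Fin m → Bool) → Bool
any {zero}  P = false
any {suc m} P = P zero ∨ any (P ∘ suc)

any-intro : (P : Fin m → Bool) (x : Fin m) → P x ≡ true → any P ≡ true
any-intro P zero    px rewrite px = refl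
any-intro P (suc x) px with P zero
... | true  = refl
... | false = any-intro (P ∘ suc) x px

any-elim : (P : Fin m → Bool) → any P ≡ true → ∃ λ x → P x ≡ true
any-elim {suc m} P e with P zero in p₀
... | true  = zero , p₀
... | false with any-elim (P ∘ suc) e
...   | x , px = suc x , px

any-cong : {P Q : Fin m → Bool} → (∀ x → P x ≡ Q x) → any P ≡ any Q
any-cong {zero}  eq = refl
any-cong {suc m} eq = cong₂ _∨_ (eq zero) (any-cong (eq ∘ suc))

∃-subset? : {Q : (Fin m → Bool) → Set} → (∀ S → Dec (Q S)) →
  (∀ {S S'} → (∀ x → S x ≡ S' x) → Q S → Q S') → Dec (∃ Q)
∃-subset? Q? Q-cong = map′
  (λ (s , qs) → lookup s , qs)
  (λ (S , qS) → tabulate S , Q-cong (λ x → sym (lookup∘tabulate S x)) qS)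
  (anySubset? (Q? ∘ lookup))

nbhd : (Fin p → Fin q → Bool) → (Fin p → Bool) → Fin q → Bool
nbhd R S v = any (λ t → S t ∧ R t v)

_⊖_ : (Fin p → Fin q → Bool) → (Fin q → Bool) → Fin p → Fin q → Bool
(R ⊖ Y) t v = R t v ∧ not (Y v)

HallCondition : (Fin p → Fin q → Bool) → (Fin p → Bool) → Set
HallCondition R L = ∀ S → S ⊆ L → count S ≤ count (nbhd R S)

record Matching (R : Fin p → Fin q → Bool) (L : Fin p → Bool) : Set where
  field
    match     : Fin p → Fin q
    related   : ∀ t → L t ≡ true → R t (match t) ≡ true
    injective : ∀ {t t'} → L t ≡ true → L t' ≡ true → match t ≡ match t' → t ≡ t'

∈nbhd : (R : Fin p → Fin q → Bool) {S : Fin p → Bool} {t : Fin p} {v : Fin q} →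
  S t ≡ true → R t v ≡ true → nbhd R S v ≡ true
∈nbhd R {S} {t} {v} st rtv = any-intro (λ t' → S t' ∧ R t' v) t (cong₂ _∧_ st rtv)

count-⊆∪ : {P Q Q' : Fin m → Bool} → P ⊆ Q ∪ Q' → count P ≤ count Q + count Q'
count-⊆∪ {P = P} {Q} {Q'} P⊆Q∪Q' = begin
  count P                        ≡⟨ count-split P Q ⟩
  count (P ∩ Q) + count (P ∖ Q)  ≤⟨ +-mono-≤ (count-mono λ x → ∧-conicalʳ (P x) _) (count-mono P∖Q⊆Q') ⟩
  count Q + count Q'             ∎
  where
  open ≤-Reasoning
  P∖Q⊆Q' : P ∖ Q ⊆ Q'
  P∖Q⊆Q' x e = subst (λ b → b ∨ Q' x ≡ true) (not-injective (∧-conicalʳ (P x) _ e))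
    (P⊆Q∪Q' x (∧-conicalˡ (P x) _ e))

nbhd⊆∪nbhd⊖ : (R : Fin p → Fin q → Bool) (Y : Fin q → Bool) (T : Fin p → Bool) →
  nbhd R T ⊆ Y ∪ nbhd (R ⊖ Y) T
nbhd⊆∪nbhd⊖ R Y T v e with any-elim (λ t → T t ∧ R t v) e
... | t , trt = ∨-true-unless λ yv →
  ∈nbhd (R ⊖ Y) {T} (∧-conicalˡ (T t) _ trt) (cong₂ _∧_ (∧-conicalʳ (T t) _ trt) (cong not yv))

⊖-related : (R : Fin p → Fin q → Bool) (Y : Fin q → Bool) {t : Fin p} {v : Fin q} →
  (R ⊖ Y) t v ≡ true → R t v ≡ true
⊖-related R Y {t} {v} = ∧-conicalˡ (R t v) _

⊖-avoids : (R : Fin p → Fin q → Bool) (Y : Fin q → Bool) {t : Fin p} {v : Fin q} →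
  (R ⊖ Y) t v ≡ true → Y v ≡ false
⊖-avoids R Y {t} {v} e = not-injective (∧-conicalʳ (R t v) _ e)

combine-matchings : {R : Fin p → Fin q → Bool} {L : Fin p → Bool} (S : Fin p → Bool) (Y : Fin q → Bool)
  (M₁ : Matching R S) → (∀ t → S t ≡ true → Y (Matching.match M₁ t) ≡ true) →
  Matching (R ⊖ Y) (L ∖ S) → Matching R L
combine-matchings {R = R} {L} S Y M₁ M₁∈Y M₂ =
  record { match = f ; related = related ; injective = injective }
  where
  module M₁ = Matching M₁
  module M₂ = Matching M₂
  f : Fin _ → Fin _
  f t = if S t then M₁.match t else M₂.match t
  related : ∀ t → L t ≡ true → R t (f t) ≡ true
  related t lt with S t in st
  ... | true  = M₁.related t st
  ... | false = ⊖-related R Y (M₂.related t (cong₂ _∧_ lt (cong not st)))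
  separated : ∀ {t t'} → L t' ≡ true → S t ≡ true → S t' ≡ false → M₁.match t ≢ M₂.match t'
  separated {t} {t'} lt' st st' eq = true≢false (begin
    true                   ≡⟨ M₁∈Y t st ⟨
    Y (M₁.match t)         ≡⟨ cong Y eq ⟩
    Y (M₂.match t')        ≡⟨ ⊖-avoids R Y (M₂.related t' (cong₂ _∧_ lt' (cong not st'))) ⟩
    false                  ∎)
    where open ≡-Reasoning
  injective : ∀ {t t'} → L t ≡ true → L t' ≡ true → f t ≡ f t' → t ≡ t'
  injective {t} {t'} lt lt' eq with S t in st | S t' in st'
  ... | true  | true  = M₁.injective st st' eq
  ... | false | false = M₂.injective (cong₂ _∧_ lt (cong not st)) (cong₂ _∧_ lt' (cong not st')) eq
  ... | true  | false = ⊥-elim (separated lt' st st' eq)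
  ... | false | true  = ⊥-elim (separated lt st' st (sym eq))

singletonMatching : (R : Fin p → Fin q → Bool) {t₀ : Fin p} {y : Fin q} → R t₀ y ≡ true → Matching R ⁅ t₀ ⁆
singletonMatching R {t₀} {y} r = record
  { match     = λ _ → y
  ; related   = λ t t=t₀ → subst (λ t → R t y ≡ true) (sym (==⇒≡ t=t₀)) r
  ; injective = λ t=t₀ t'=t₀ _ → trans (==⇒≡ t=t₀) (sym (==⇒≡ t'=t₀))
  }

hall-⊖-critical : {R : Fin p → Fin q → Bool} {L S : Fin p → Bool} → HallCondition R L → S ⊆ L →
  count (nbhd R S) ≤ count S → HallCondition (R ⊖ nbhd R S) (L ∖ S)
hall-⊖-critical {R = R} {L} {S} hall-RL S⊆L tight T T⊆L∖S = +-cancelˡ-≤ (count S) _ _ (begin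
  count S + count T                        ≡⟨ count-disjoint-∪ T∩S=∅ ⟨
  count (T ∪ S)                            ≤⟨ hall-RL (T ∪ S) T∪S⊆L ⟩
  count (nbhd R (T ∪ S))                   ≤⟨ count-⊆∪ (nbhd⊆∪nbhd⊖ R Y (T ∪ S)) ⟩
  count Y + count (nbhd (R ⊖ Y) (T ∪ S))   ≤⟨ +-mono-≤ tight (count-mono nbhd⊖Y-from-T) ⟩
  count S + count (nbhd (R ⊖ Y) T)         ∎)
  where
  open ≤-Reasoning
  Y = nbhd R S
  T∩S=∅ : ∀ t → T t ≡ true → S t ≡ false
  T∩S=∅ t tt = not-injective (∧-conicalʳ (L t) _ (T⊆L∖S t tt))
  T∪S⊆L : T ∪ S ⊆ L
  T∪S⊆L t e with ∨-elim {T t} e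
  ... | inj₁ tt = ∖⊆ L S t (T⊆L∖S t tt)
  ... | inj₂ st = S⊆L t st
  nbhd⊖Y-from-T : nbhd (R ⊖ Y) (T ∪ S) ⊆ nbhd (R ⊖ Y) T
  nbhd⊖Y-from-T v e with any-elim (λ t → (T ∪ S) t ∧ (R ⊖ Y) t v) e
  ... | t , e' with ∨-elim {T t} (∧-conicalˡ ((T ∪ S) t) _ e')
  ...   | inj₁ tt = ∈nbhd (R ⊖ Y) {T} tt (∧-conicalʳ ((T ∪ S) t) _ e')
  ...   | inj₂ st = ⊥-elim (true≢false (trans (sym (∈nbhd R st (⊖-related R Y r))) (⊖-avoids R Y r)))
    where r = ∧-conicalʳ ((T ∪ S) t) _ e'

hall-⊖-surplus : {R : Fin p → Fin q → Bool} {L : Fin p → Bool} →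
  (∀ T → T ⊆ L → 0 < count T → count T < count (nbhd R T)) → (y : Fin q) → HallCondition (R ⊖ ⁅ y ⁆) L
hall-⊖-surplus {R = R} surplus y T T⊆L with count T in cT
... | zero  = z≤n
... | suc c = ≤-pred (begin-strict
  suc c                                   ≡⟨ cT ⟨
  count T                                 <⟨ surplus T T⊆L (subst (0 <_) (sym cT) (s≤s z≤n)) ⟩
  count (nbhd R T)                        ≤⟨ count-⊆∪ (nbhd⊆∪nbhd⊖ R ⁅ y ⁆ T) ⟩
  count ⁅ y ⁆ + count (nbhd (R ⊖ ⁅ y ⁆) T) ≡⟨ cong (_+ count (nbhd (R ⊖ ⁅ y ⁆) T)) (count-singleton y) ⟩
  suc (count (nbhd (R ⊖ ⁅ y ⁆) T))        ∎)
  where open ≤-Reasoning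

Critical : (Fin p → Fin q → Bool) → (Fin p → Bool) → Fin p → (Fin p → Bool) → Set
Critical R L t₀ S = S ⊆ L × S t₀ ≡ false × 0 < count S × count (nbhd R S) ≤ count S

critical? : (R : Fin p → Fin q → Bool) (L : Fin p → Bool) (t₀ : Fin p) → ∀ S → Dec (Critical R L t₀ S)
critical? R L t₀ S = all? (λ t → (S t ≟ᵇ true) →-dec (L t ≟ᵇ true)) ×-dec (S t₀ ≟ᵇ false)
  ×-dec (1 ≤? count S) ×-dec (count (nbhd R S) ≤? count S)

critical-cong : (R : Fin p → Fin q → Bool) (L : Fin p → Bool) (t₀ : Fin p) {S S' : Fin p → Bool} →
  (∀ t → S t ≡ S' t) → Critical R L t₀ S → Critical R L t₀ S'
critical-cong R L t₀ {S} {S'} S=S' (S⊆L , st₀ , S≠∅ , tight) =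
  (λ t s't → S⊆L t (trans (S=S' t) s't)) , trans (sym (S=S' t₀)) st₀ ,
  subst (0 <_) S=S'-count S≠∅ ,
  subst₂ _≤_ (count-cong λ v → any-cong λ t → cong (_∧ R t v) (S=S' t)) S=S'-count tight
  where
  S=S'-count : count S ≡ count S'
  S=S'-count = count-cong S=S'

HallUpTo : ∀ {p q} → ℕ → Set
HallUpTo {p} {q} k =
  (R : Fin p → Fin q → Bool) (L : Fin p → Bool) → count L ≤ k → HallCondition R L → Matching R L

critical-step : ∀ {k} → HallUpTo {p} {q} k → ∀ {R L t₀ S} → count L ≤ suc k → HallCondition R L →
  L t₀ ≡ true → Critical R L t₀ S → Matching R L
critical-step ih {R} {L} {t₀} {S} L≤1+k hall-RL lt₀ (S⊆L , st₀ , S≠∅ , tight) =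
  combine-matchings S (nbhd R S) M₁ (λ t st → ∈nbhd R st (Matching.related M₁ t st)) M₂
  where
  M₁ : Matching R S
  M₁ = ih R S (≤-pred (≤-trans (count-strict S⊆L t₀ lt₀ st₀) L≤1+k)) λ T T⊆S → hall-RL T λ t → S⊆L t ∘ T⊆S t
  s∈S = proj₂ (0<count⇒∃ S S≠∅)
  M₂ : Matching (R ⊖ nbhd R S) (L ∖ S)
  M₂ = ih (R ⊖ nbhd R S) (L ∖ S) (≤-pred (≤-trans (count-∖< L S (S⊆L _ s∈S) s∈S) L≤1+k))
    (hall-⊖-critical {R = R} hall-RL S⊆L tight)

surplus-step : ∀ {k} → HallUpTo {p} {q} k → ∀ {R L t₀} → count L ≤ suc k → HallCondition R L →
  L t₀ ≡ true → ¬ ∃ (Critical R L t₀) → Matching R L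
surplus-step ih {R} {L} {t₀} L≤1+k hall-RL lt₀ no-critical =
  combine-matchings ⁅ t₀ ⁆ ⁅ y ⁆ (singletonMatching R Rt₀y) (λ _ _ → ==-refl y) M
  where
  t₀∈nbhd : ∃ λ y → nbhd R ⁅ t₀ ⁆ y ≡ true
  t₀∈nbhd = 0<count⇒∃ (nbhd R ⁅ t₀ ⁆) (≤-trans (∈⇒0<count ⁅ t₀ ⁆ t₀ (==-refl t₀))
    (hall-RL ⁅ t₀ ⁆ λ t t=t₀ → subst (λ t → L t ≡ true) (sym (==⇒≡ t=t₀)) lt₀))
  y = proj₁ t₀∈nbhd
  Rt₀y : R t₀ y ≡ true
  Rt₀y with any-elim (λ t → ⁅ t₀ ⁆ t ∧ R t y) (proj₂ t₀∈nbhd)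
  ... | t , e = subst (λ t → R t y ≡ true) (==⇒≡ (∧-conicalˡ (⁅ t₀ ⁆ t) _ e)) (∧-conicalʳ (⁅ t₀ ⁆ t) _ e)
  surplus : ∀ T → T ⊆ L ∖ ⁅ t₀ ⁆ → 0 < count T → count T < count (nbhd R T)
  surplus T T⊆ T≠∅ = ≰⇒> λ tight → no-critical (T , (λ t → ∖⊆ L ⁅ t₀ ⁆ t ∘ T⊆ t) , t₀∉T , T≠∅ , tight)
    where
    t₀∉T : T t₀ ≡ false
    t₀∉T = ¬-not λ tt₀ → true≢false (trans (sym (T⊆ t₀ tt₀)) (∖-excludes L {⁅ t₀ ⁆} (==-refl t₀)))
  M : Matching (R ⊖ ⁅ y ⁆) (L ∖ ⁅ t₀ ⁆)
  M = ih (R ⊖ ⁅ y ⁆) (L ∖ ⁅ t₀ ⁆) (≤-pred (≤-trans (count-∖< L ⁅ t₀ ⁆ lt₀ (==-refl t₀)) L≤1+k))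
    (hall-⊖-surplus surplus y)

hall-upTo : (k : ℕ) → (Fin p → Fin q) → HallUpTo {p} {q} k
hall-upTo k default R L L≤k hall-RL with any? (λ t → L t ≟ᵇ true)
... | no L=∅ = record
  { match = default
  ; related = λ t lt → ⊥-elim (L=∅ (t , lt))
  ; injective = λ {t} lt _ _ → ⊥-elim (L=∅ (t , lt))
  }
hall-upTo zero _ R L L≤0 hall-RL | yes (t₀ , lt₀) = ⊥-elim (<⇒≱ (∈⇒0<count L t₀ lt₀) L≤0)
hall-upTo (suc k) default R L L≤1+k hall-RL | yes (t₀ , lt₀)
  with ∃-subset? (critical? R L t₀) (critical-cong R L t₀)
... | yes (S , critical) = critical-step (hall-upTo k default) L≤1+k hall-RL lt₀ critical
... | no  no-critical    = surplus-step (hall-upTo k default) L≤1+k hall-RL lt₀ no-critical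

-- The default is only the (irrelevant) value of the matching off L.
hall : (Fin p → Fin q) → (R : Fin p → Fin q → Bool) (L : Fin p → Bool) → HallCondition R L → Matching R L
hall default R L = hall-upTo (count L) default R L ≤-refl

-- Distinct representatives of complements

record PrivatePartner (C : Fin p → Fin m → Bool) (t : Fin p) (x : Fin m) : Set where
  field
    partner  : Fin m
    ∈clique  : C t partner ≡ true
    unshared : ∀ t' → t' ≢ t → C t' x ≡ true → C t' partner ≡ false

Irredundant : (Fin p → Fin m → Bool) → Set
Irredundant C = ∀ t x → C t x ≡ true → PrivatePartner C t x

Proper : (Fin p → Fin m → Bool) → Set
Proper C = ∀ t → ∃ λ v → C t v ≡ false

module _ (C : Fin p → Fin m → Bool) where

  private
    R : Fin p → Fin m → Bool
    R t v = not (C t v)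

  hall-small : Proper C → ∀ S → count S ≤ 1 → count S ≤ count (nbhd R S)
  hall-small proper S S≤1 with count S in cS
  ... | zero  = z≤n
  ... | suc _ with 0<count⇒∃ S (subst (0 <_) (sym cS) (s≤s z≤n))
  ...   | t , st = ≤-trans S≤1 (∈⇒0<count (nbhd R S) _ (∈nbhd R st (cong not (proj₂ (proper t)))))

  hall-no-common-member : p ≤ m → ∀ S → (∀ x → ¬ (∀ t → S t ≡ true → C t x ≡ true)) →
    count S ≤ count (nbhd R S)
  hall-no-common-member p≤m S no-common = begin
    count S            ≤⟨ count≤size S ⟩
    p                  ≤⟨ p≤m ⟩
    m                  ≡⟨ count-full nbhd-full ⟨
    count (nbhd R S)   ∎
    where
    open ≤-Reasoning
    nbhd-full : ∀ x → nbhd R S x ≡ true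
    nbhd-full x with ¬∀⟶∃¬ _ _ (λ t → (S t ≟ᵇ true) →-dec (C t x ≟ᵇ true)) (no-common x)
    ... | t , ¬S⇒C with S t in st
    ...   | true  = ∈nbhd R st (cong not (¬-not λ ctx → ¬S⇒C λ _ → ctx))
    ...   | false = ⊥-elim (¬S⇒C λ ())

  -- The private partners of a common member in the cliques of S are distinct
  -- and each lies outside some other clique of S.
  hall-common-member : Irredundant C → ∀ S x → (∀ t → S t ≡ true → C t x ≡ true) → 2 ≤ count S →
    count S ≤ count (nbhd R S)
  hall-common-member irredundant S x common 2≤S =
    count-injection S (nbhd R S) partner partner∈nbhd partner-injective
    where
    partner : ∀ t → S t ≡ true → Fin m
    partner t st = PrivatePartner.partner (irredundant t x (common t st))
    private-partner : ∀ {t} st t' → t' ≢ t → S t' ≡ true → C t' (partner t st) ≡ false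
    private-partner {t} st t' t'≢t st' =
      PrivatePartner.unshared (irredundant t x (common t st)) t' t'≢t (common t' st')
    partner∈nbhd : ∀ t st → nbhd R S (partner t st) ≡ true
    partner∈nbhd t st with 2≤count⇒∃≢ S 2≤S t
    ... | t' , st' , t'≢t = ∈nbhd R st' (cong not (private-partner st t' t'≢t st'))
    partner-injective : ∀ {t t'} st st' → partner t st ≡ partner t' st' → t ≡ t'
    partner-injective {t} {t'} st st' eq with t' ≟ t
    ... | yes t'≡t = sym t'≡t
    ... | no  t'≢t = ⊥-elim (true≢false (begin
      true                    ≡⟨ PrivatePartner.∈clique (irredundant t' x (common t' st')) ⟨
      C t' (partner t' st')   ≡⟨ cong (C t') eq ⟨
      C t' (partner t st)     ≡⟨ private-partner st t' t'≢t st' ⟩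
      false                   ∎))
      where open ≡-Reasoning

  complement-SDR : p ≤ m → Irredundant C → Proper C →
    Σ (Fin p → Fin m) λ f → (∀ t → C t (f t) ≡ false) × Injective _≡_ _≡_ f
  complement-SDR p≤m irredundant proper =
    M.match , (λ t → not-injective (M.related t refl)) , M.injective refl refl
    where
    hall-R : HallCondition R (λ _ → true)
    hall-R S _ with 2 ≤? count S | any? (λ x → all? (λ t → (S t ≟ᵇ true) →-dec (C t x ≟ᵇ true)))
    ... | no  S<2 | _                = hall-small proper S (≤-pred (≰⇒> S<2))
    ... | yes 2≤S | yes (x , common) = hall-common-member irredundant S x common 2≤S
    ... | yes _   | no  no-common    = hall-no-common-member p≤m S λ x common → no-common (x , common)
    module M = Matching (hall (λ t → inject≤ t p≤m) R (λ _ → true) hall-R)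

-- Shrinking a cover to an irredundant one

sum : (Fin p → ℕ) → ℕ
sum {zero}  f = 0
sum {suc p} f = f zero + sum (f ∘ suc)

sum-mono : {f g : Fin p → ℕ} → (∀ t → f t ≤ g t) → sum f ≤ sum g
sum-mono {zero}  f≤g = z≤n
sum-mono {suc p} f≤g = +-mono-≤ (f≤g zero) (sum-mono (f≤g ∘ suc))

sum-strict : {f g : Fin p → ℕ} → (∀ t → f t ≤ g t) → (t : Fin p) → f t < g t → sum f < sum g
sum-strict f≤g zero    f<g = +-mono-<-≤ f<g (sum-mono (f≤g ∘ suc))
sum-strict f≤g (suc t) f<g = +-mono-≤-< (f≤g zero) (sum-strict (f≤g ∘ suc) t f<g)

CoveredElsewhere : (Fin p → Fin m → Bool) → Fin p → Fin m → Fin m → Set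
CoveredElsewhere C t x y = C t y ≡ true → y ≢ x → ∃ λ t' → t' ≢ t × C t' x ≡ true × C t' y ≡ true

coveredElsewhere? : (C : Fin p → Fin m → Bool) (t : Fin p) (x y : Fin m) → Dec (CoveredElsewhere C t x y)
coveredElsewhere? C t x y = (C t y ≟ᵇ true) →-dec ¬? (y ≟ x) →-dec
  any? λ t' → ¬? (t' ≟ t) ×-dec (C t' x ≟ᵇ true) ×-dec (C t' y ≟ᵇ true)

Removable : (Fin p → Fin m → Bool) → Fin p → Fin m → Set
Removable C t x = C t x ≡ true × (∀ y → CoveredElsewhere C t x y)

removable? : (C : Fin p → Fin m → Bool) (t : Fin p) (x : Fin m) → Dec (Removable C t x)
removable? C t x = (C t x ≟ᵇ true) ×-dec all? (coveredElsewhere? C t x)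

no-removable⇒irredundant : (C : Fin p → Fin m → Bool) → (∀ t x → ¬ Removable C t x) → Irredundant C
no-removable⇒irredundant C none t x cx
  with ¬∀⟶∃¬ _ _ (coveredElsewhere? C t x) (λ shared → none t x (cx , shared))
... | y , unshared = record
  { partner  = y
  ; ∈clique  = decidable-stable (C t y ≟ᵇ true) λ ¬cy → unshared λ cy → ⊥-elim (¬cy cy)
  ; unshared = λ t' t'≢t cx' → ¬-not λ cy' → unshared λ _ _ → t' , t'≢t , cx' , cy'
  }

remove : (Fin p → Fin m → Bool) → Fin p → Fin m → Fin p → Fin m → Bool
remove C t x t' = C t' ∖ λ v → (t' == t) ∧ (v == x)

remove-⊆ : (C : Fin p → Fin m → Bool) {t : Fin p} {x : Fin m} (t' : Fin p) → remove C t x t' ⊆ C t'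
remove-⊆ C t' = ∖⊆ (C t') _

remove-keeps : (C : Fin p → Fin m → Bool) {t t' : Fin p} {x v : Fin m} → C t' v ≡ true → t' ≢ t ⊎ v ≢ x →
  remove C t x t' v ≡ true
remove-keeps C cv (inj₁ t'≢t) = cong₂ _∧_ cv (cong (not ∘ (_∧ _)) (≢⇒==false t'≢t))
remove-keeps C cv (inj₂ v≢x)  = cong₂ _∧_ cv (cong not (trans (cong (_ ∧_) (≢⇒==false v≢x)) (∧-zeroʳ _)))

remove-shrinks : (C : Fin p → Fin m → Bool) {t : Fin p} {x : Fin m} → C t x ≡ true →
  sum (λ t' → count (remove C t x t')) < sum (λ t' → count (C t'))
remove-shrinks C {t} {x} cx = sum-strict (λ t' → count-mono (remove-⊆ C t')) t
  (count-∖< (C t) _ cx (cong₂ _∧_ (==-refl t) (==-refl x)))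

pair-survives-removal : (C : Fin p → Fin m → Bool) {t t₁ : Fin p} {x u v : Fin m} →
  (∀ y → CoveredElsewhere C t x y) → u ≢ v →
  C t₁ u ≡ true → C t₁ v ≡ true → Dec (t₁ ≡ t) → Dec (u ≡ x) → Dec (v ≡ x) →
  ∃ λ t' → remove C t x t' u ≡ true × remove C t x t' v ≡ true
pair-survives-removal C shared u≢v cu cv (no t₁≢t) _ _ =
  _ , remove-keeps C cu (inj₁ t₁≢t) , remove-keeps C cv (inj₁ t₁≢t)
pair-survives-removal C shared u≢v cu cv (yes _) (no u≢x) (no v≢x) =
  _ , remove-keeps C cu (inj₂ u≢x) , remove-keeps C cv (inj₂ v≢x)
pair-survives-removal C shared u≢v cu cv (yes refl) (yes refl) (yes refl) = ⊥-elim (u≢v refl)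
pair-survives-removal C shared u≢v cu cv (yes refl) (yes refl) (no v≢x) with shared _ cv v≢x
... | t' , t'≢t , cx , cv' = t' , remove-keeps C cx (inj₁ t'≢t) , remove-keeps C cv' (inj₁ t'≢t)
pair-survives-removal C shared u≢v cu cv (yes refl) (no u≢x) (yes refl) with shared _ cu u≢x
... | t' , t'≢t , cx , cu' = t' , remove-keeps C cu' (inj₁ t'≢t) , remove-keeps C cx (inj₁ t'≢t)

adj⇒≢ : (G : Graph) {u v : Fin (n G)} → adj G u v ≡ true → u ≢ v
adj⇒≢ G {u} uv refl = true≢false (trans (sym uv) (adj-irrefl G u))

module _ (G : Graph) where

  Covers : (Fin p → Fin (n G) → Bool) → Set
  Covers C = ∀ u v → adj G u v ≡ true → ∃ λ t → C t u ≡ true × C t v ≡ true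

  remove-covers : {C : Fin p → Fin (n G) → Bool} {t : Fin p} {x : Fin (n G)} →
    Removable C t x → Covers C → Covers (remove C t x)
  remove-covers {C = C} {t} {x} (_ , shared) cover u v uv with cover u v uv
  ... | t₁ , cu , cv = pair-survives-removal C shared (adj⇒≢ G uv) cu cv (t₁ ≟ t) (u ≟ x) (v ≟ x)

  irredundant-refinement : (k : ℕ) (C : Fin p → Fin (n G) → Bool) → sum (λ t → count (C t)) ≤ k → Covers C →
    ∃ λ C' → (∀ t → C' t ⊆ C t) × Covers C' × Irredundant C'
  irredundant-refinement k C C≤k cover with any? (λ t → any? (removable? C t))
  ... | no none = C , (λ _ _ → id) , cover , no-removable⇒irredundant C λ t x r → none (t , x , r)
  irredundant-refinement zero C C≤0 cover | yes (t , x , cx , _) =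
    ⊥-elim (n≮0 (<-≤-trans (remove-shrinks C cx) C≤0))
  irredundant-refinement (suc k) C C≤1+k cover | yes (t , x , r)
    with irredundant-refinement k (remove C t x) (≤-pred (<-≤-trans (remove-shrinks C (proj₁ r)) C≤1+k))
           (remove-covers r cover)
  ... | C' , C'⊆ , cover' , irredundant = C' , (λ t' v → remove-⊆ C t' v ∘ C'⊆ t' v) , cover' , irredundant

-- The digraph of a cover with distinct representatives

module SDRDigraph (C : Fin p → Fin m → Bool) (f : Fin p → Fin m) (f∉C : ∀ t → C t (f t) ≡ false)
                  (f-injective : Injective _≡_ _≡_ f) where

  arcᵇ : Fin m → Fin m → Bool
  arcᵇ u w = any λ t → (f t == w) ∧ C t u

  arc-intro : ∀ {t u} → C t u ≡ true → arcᵇ u (f t) ≡ true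
  arc-intro {t} {u} cu = any-intro (λ t' → (f t' == f t) ∧ C t' u) t (cong₂ _∧_ (==-refl (f t)) cu)

  private
    witness : ∀ {u w} → arcᵇ u w ≡ true → ∃ λ t → (f t == w) ∧ C t u ≡ true
    witness {u} {w} = any-elim (λ t → (f t == w) ∧ C t u)

  arc-clique : ∀ {u w} → arcᵇ u w ≡ true → Fin p
  arc-clique = proj₁ ∘ witness

  arc-clique-target : ∀ {u w} (uw : arcᵇ u w ≡ true) → f (arc-clique uw) ≡ w
  arc-clique-target uw = ==⇒≡ (∧-conicalˡ (f (arc-clique uw) == _) _ (proj₂ (witness uw)))

  arc-clique-source : ∀ {u w} (uw : arcᵇ u w ≡ true) → C (arc-clique uw) u ≡ true
  arc-clique-source uw = ∧-conicalʳ (f (arc-clique uw) == _) _ (proj₂ (witness uw))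

  arc-elim-at : ∀ {t u} → arcᵇ u (f t) ≡ true → C t u ≡ true
  arc-elim-at uw = subst (λ s → C s _ ≡ true) (f-injective (arc-clique-target uw)) (arc-clique-source uw)

  no-loop : ∀ u → arcᵇ u u ≡ false
  no-loop u = ¬-not λ uu → true≢false (trans (sym (arc-clique-source uu))
    (subst (λ w → C (arc-clique uu) w ≡ false) (arc-clique-target uu) (f∉C _)))

  D : Digraph m
  D = record { arc = arcᵇ ; loopless = no-loop }

  indeg≤ : ∀ {i} → (∀ t → count (C t) ≤ i) → ∀ w → indeg D w ≤ i
  indeg≤ C≤i w with any? (λ t → f t ≟ w)
  ... | yes (t , refl) = ≤-trans (count-mono {P = λ u → arcᵇ u (f t)} λ u → arc-elim-at) (C≤i t)
  ... | no  w∉f = subst (_≤ _) (sym (count-empty {P = λ u → arcᵇ u w} λ u → ¬-not λ uw →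
    w∉f (arc-clique uw , arc-clique-target uw))) z≤n

  outdeg≤ : ∀ u → outdeg D u ≤ count (λ t → C t u)
  outdeg≤ u = count-injection (λ w → arcᵇ u w) (λ t → C t u) (λ _ → arc-clique) (λ _ → arc-clique-source)
    λ uw uw' eq → trans (sym (arc-clique-target uw)) (trans (cong f eq) (arc-clique-target uw'))

sdr⇒competition : (G : Graph) {i j : ℕ} (C : Fin p → Fin (n G) → Bool) →
  (∀ t → IsClique G (C t)) → Covers G C →
  (∀ t → count (C t) ≤ i) → (∀ v → count (λ t → C t v) ≤ j) →
  (f : Fin p → Fin (n G)) → (∀ t → C t (f t) ≡ false) → Injective _≡_ _≡_ f → IsIJCompetitionGraph i j G
sdr⇒competition G C cliques cover C≤i C∋≤j f f∉C f-injective =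
  D , (indeg≤ C≤i , λ u → ≤-trans (outdeg≤ u) (C∋≤j u)) , λ u v → mk⇔ (edge⇒common u v) (common⇒edge u v)
  where
  open SDRDigraph C f f∉C f-injective
  edge⇒common : ∀ u v → adj G u v ≡ true → u ≢ v × ∃ λ w → arcᵇ u w ≡ true × arcᵇ v w ≡ true
  edge⇒common u v uv with cover u v uv
  ... | t , cu , cv = adj⇒≢ G uv , f t , arc-intro cu , arc-intro cv
  common⇒edge : ∀ u v → u ≢ v × (∃ λ w → arcᵇ u w ≡ true × arcᵇ v w ≡ true) → adj G u v ≡ true
  common⇒edge u v (u≢v , w , uw , vw) = cliques (arc-clique uw) u v (arc-clique-source uw)
    (arc-elim-at (subst (λ w → arcᵇ v w ≡ true) (sym (arc-clique-target uw)) vw)) u≢v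

Complete : Graph → Set
Complete G = ∀ u v → u ≢ v → adj G u v ≡ true

kadj-≢ : ∀ {m} {u v : Fin m} → u ≢ v → kadj u v ≡ true
kadj-≢ {u = u} {v} u≢v with u ≟ v
... | yes u≡v = ⊥-elim (u≢v u≡v)
... | no  _   = refl

complete⇒≅K : (G : Graph) → Complete G → G ≅ K (n G)
complete⇒≅K G complete = ↔-id _ , preserves
  where
  preserves : ∀ u v → adj G u v ≡ kadj u v
  preserves u v with u ≟ v
  ... | yes refl = adj-irrefl G u
  ... | no  u≢v  = complete u v u≢v

≅K⇒complete : (G : Graph) {m : ℕ} → G ≅ K m → Complete G
≅K⇒complete G (φ , preserves) u v u≢v = trans (preserves u v) (kadj-≢ λ φu≡φv → u≢v (begin
  u                         ≡⟨ Inverse.strictlyInverseʳ φ u ⟨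
  Inverse.from φ (Inverse.to φ u) ≡⟨ cong (Inverse.from φ) φu≡φv ⟩
  Inverse.from φ (Inverse.to φ v) ≡⟨ Inverse.strictlyInverseʳ φ v ⟩
  v                         ∎))
  where open ≡-Reasoning

≅K⇒adjacent-01 : (G : Graph) {m : ℕ} (φ : G ≅ K (suc (suc m))) →
  adj G (Inverse.from (proj₁ φ) zero) (Inverse.from (proj₁ φ) (suc zero)) ≡ true
≅K⇒adjacent-01 G (φ , preserves) = trans (preserves _ _)
  (cong₂ kadj (Inverse.strictlyInverseˡ φ zero) (Inverse.strictlyInverseˡ φ (suc zero)))

-- Necessity of the conditions

module CompetitionGraph (G : Graph) (D : Digraph (n G)) (competition : IsCompetitionGraphOf G D) where

  prey-ecc : ∀ {i j} → IsIJDigraph i j D → ECC G i j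
  prey-ecc (indeg≤i , outdeg≤j) = record
    { p       = n G
    ; cl      = λ w u → arc D u w
    ; cliques = λ w u v uw vw u≢v → Equivalence.from (competition u v) (u≢v , w , uw , vw)
    ; covers  = λ u v uv → proj₂ (Equivalence.to (competition u v) uv)
    ; size≤i  = indeg≤i
    ; deg≤j   = outdeg≤j
    ; p≤n     = ≤-refl
    }

  edge⇒common-prey : ∀ {u v} → adj G u v ≡ true → ∃ λ w → arc D u w ≡ true × arc D v w ≡ true × w ≢ u × w ≢ v
  edge⇒common-prey uv with Equivalence.to (competition _ _) uv
  ... | _ , w , uw , vw = w , uw , vw , no-loop uw , no-loop vw
    where
    no-loop : ∀ {x} → arc D x w ≡ true → w ≢ x
    no-loop xw refl = true≢false (trans (sym xw) (loopless D w))

  competition-graph-≇K₂ : ¬ G ≅ K 2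
  competition-graph-≇K₂ (φ , preserves) with edge⇒common-prey (≅K⇒adjacent-01 G (φ , preserves))
  ... | w , _ , _ , w≢a , w≢b with Inverse.to φ w in φw
  ...   | zero          = w≢a (trans (sym (Inverse.strictlyInverseʳ φ w)) (cong (Inverse.from φ) φw))
  ...   | suc zero      = w≢b (trans (sym (Inverse.strictlyInverseʳ φ w)) (cong (Inverse.from φ) φw))

  outdeg≤1⇒¬NontrivialComplete : (∀ u → outdeg D u ≤ 1) → ¬ NontrivialComplete G
  outdeg≤1⇒¬NontrivialComplete outdeg≤1 (suc (suc m) , s≤s (s≤s z≤n) , φ)
    with edge⇒common-prey (≅K⇒adjacent-01 G φ)
  ... | w , aw , _ , w≢a , _ with edge⇒common-prey (≅K⇒complete G φ w _ w≢a)
  ...   | z , _ , az , z≢w , _ = z≢w (count≤1⇒unique (arc D _) (outdeg≤1 _) az aw)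

competition⇒conditions : (G : Graph) (i j : ℕ) → IsIJCompetitionGraph i j G →
  ¬ (G ≅ K 2) × (j ≡ 1 → ¬ NontrivialComplete G) × ECC G i j
competition⇒conditions G i j (D , ij-digraph , competition) =
  competition-graph-≇K₂ , (λ { refl → outdeg≤1⇒¬NontrivialComplete (proj₂ ij-digraph) }) , prey-ecc ij-digraph
  where open CompetitionGraph G D competition

-- Sufficiency of the conditions

proper-ecc⇒competition : (G : Graph) {i j : ℕ} (E : ECC G i j) → Proper (ECC.cl E) →
  IsIJCompetitionGraph i j G
proper-ecc⇒competition G {i} {j} E proper = from-refinement (irredundant-refinement G _ cl ≤-refl covers)
  where
  open ECC E
  from-refinement : (∃ λ C → (∀ t → C t ⊆ cl t) × Covers G C × Irredundant C) → IsIJCompetitionGraph i j G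
  from-refinement (C , C⊆cl , cover , irredundant) with complement-SDR C p≤n irredundant C-proper
    where
    C-proper : Proper C
    C-proper t with proper t
    ... | v , v∉cl = v , ¬-not λ v∈C → true≢false (trans (sym (C⊆cl t v v∈C)) v∉cl)
  ... | f , f∉C , f-injective = sdr⇒competition G C
    (λ t u v u∈C v∈C → cliques t u v (C⊆cl t u u∈C) (C⊆cl t v v∈C)) cover
    (λ t → ≤-trans (count-mono (C⊆cl t)) (size≤i t))
    (λ v → ≤-trans (count-mono λ t → C⊆cl t v) (deg≤j v))
    f f∉C f-injective

≤1⇒edgeless : (G : Graph) → n G ≤ 1 → ∀ u v → adj G u v ≡ false
≤1⇒edgeless G G≤1 u v = subst (λ w → adj G u w ≡ false) (toℕ-injective (trans (toℕ≡0 u) (sym (toℕ≡0 v))))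
  (adj-irrefl G u)
  where
  toℕ≡0 : (w : Fin (n G)) → toℕ w ≡ 0
  toℕ≡0 w = n≤0⇒n≡0 (≤-pred (≤-trans (toℕ<n w) G≤1))

edgeless⇒competition : (G : Graph) {i j : ℕ} → (∀ u v → adj G u v ≡ false) → IsIJCompetitionGraph i j G
edgeless⇒competition G edgeless = proper-ecc⇒competition G empty-ecc λ ()
  where
  empty-ecc : ECC G _ _
  empty-ecc = record
    { p = 0 ; cl = λ () ; cliques = λ () ; size≤i = λ () ; deg≤j = λ _ → z≤n ; p≤n = z≤n
    ; covers = λ u v uv → ⊥-elim (true≢false (trans (sym uv) (edgeless u v)))
    }

three-points : ∀ {m} → 3 ≤ m → Σ (Fin m) λ a₀ → Σ (Fin m) λ a₁ → Σ (Fin m) λ a₂ → a₀ ≢ a₁ × a₂ ≢ a₀ × a₂ ≢ a₁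
three-points (s≤s (s≤s (s≤s _))) = zero , suc zero , suc (suc zero) , (λ ()) , (λ ()) , (λ ())

-- Membership of a vertex v in K_m − a₀, K_m − a₁ and the edge a₀a₁, given v == a₀ and v == a₁.
triangleᵇ : Bool → Bool → Fin 3 → Bool
triangleᵇ v=a₀ v=a₁ zero             = not v=a₀
triangleᵇ v=a₀ v=a₁ (suc zero)       = not v=a₁
triangleᵇ v=a₀ v=a₁ (suc (suc zero)) = v=a₀ ∨ v=a₁

count-triangleᵇ≤2 : ∀ x y → count (triangleᵇ x y) ≤ 2
count-triangleᵇ≤2 true  true  = s≤s z≤n
count-triangleᵇ≤2 true  false = ≤-refl
count-triangleᵇ≤2 false true  = ≤-refl
count-triangleᵇ≤2 false false = ≤-refl

complete⇒triangle-ecc : (G : Graph) {i j : ℕ} → Complete G → 3 ≤ n G → n G ≤ i → 2 ≤ j →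
  Σ (ECC G i j) λ E → Proper (ECC.cl E)
complete⇒triangle-ecc G complete 3≤n n≤i 2≤j with three-points 3≤n
... | a₀ , a₁ , a₂ , a₀≢a₁ , a₂≢a₀ , a₂≢a₁ = record
  { p       = 3
  ; cl      = C
  ; cliques = λ t u v _ _ → complete u v
  ; covers  = cover
  ; size≤i  = λ t → ≤-trans (count≤size (C t)) n≤i
  ; deg≤j   = λ v → ≤-trans (count-triangleᵇ≤2 (v == a₀) (v == a₁)) 2≤j
  ; p≤n     = 3≤n
  } , proper
  where
  C : Fin 3 → Fin (n G) → Bool
  C t v = triangleᵇ (v == a₀) (v == a₁) t
  proper : Proper C
  proper zero             = a₀ , cong not (==-refl a₀)
  proper (suc zero)       = a₁ , cong not (==-refl a₁)
  proper (suc (suc zero)) = a₂ , cong₂ _∨_ (≢⇒==false a₂≢a₀) (≢⇒==false a₂≢a₁)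
  a₀≠a₁ : ∀ {u} → u ≡ a₀ → not (u == a₁) ≡ true
  a₀≠a₁ refl = cong not (≢⇒==false a₀≢a₁)
  cover : Covers G C
  cover u v uv with u ≟ a₀ | v ≟ a₀
  ... | no  _    | no  _    = zero , refl , refl
  ... | yes refl | yes refl = ⊥-elim (adj⇒≢ G uv refl)
  ... | yes u=a₀ | no  _ with v ≟ a₁
  ...   | yes _ = suc (suc zero) , refl , refl
  ...   | no  _ = suc zero , a₀≠a₁ u=a₀ , refl
  cover u v uv | no _ | yes v=a₀ with u ≟ a₁
  ...   | yes _ = suc (suc zero) , refl , refl
  ...   | no  _ = suc zero , refl , a₀≠a₁ v=a₀

complete⇒competition : (G : Graph) {i j : ℕ} → Complete G → n G ≤ i → 1 ≤ j → ¬ G ≅ K 2 →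
  (j ≡ 1 → ¬ NontrivialComplete G) → IsIJCompetitionGraph i j G
complete⇒competition G complete n≤i 1≤j ≇K₂ ¬nontrivial with n G ≤? 1
... | yes n≤1 = edgeless⇒competition G (≤1⇒edgeless G n≤1)
... | no  n≰1 = uncurry (proper-ecc⇒competition G) (complete⇒triangle-ecc G complete 3≤n n≤i 2≤j)
  where
  2≤n : 2 ≤ n G
  2≤n = ≰⇒> n≰1
  3≤n : 3 ≤ n G
  3≤n = ≤∧≢⇒< 2≤n λ 2≡n → ≇K₂ (subst (λ m → G ≅ K m) (sym 2≡n) (complete⇒≅K G complete))
  2≤j : 2 ≤ _
  2≤j = ≤∧≢⇒< 1≤j λ 1≡j → ¬nontrivial (sym 1≡j) (n G , 2≤n , complete⇒≅K G complete)

conditions⇒competition : (G : Graph) (i j : ℕ) → 1 ≤ j →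
  ¬ (G ≅ K 2) × (j ≡ 1 → ¬ NontrivialComplete G) × ECC G i j → IsIJCompetitionGraph i j G
conditions⇒competition G i j 1≤j (≇K₂ , ¬nontrivial , E) with any? (λ t → all? (λ v → ECC.cl E t v ≟ᵇ true))
... | yes (t , full) = complete⇒competition G (λ u v → ECC.cliques E t u v (full u) (full v))
  (subst (_≤ i) (count-full full) (ECC.size≤i E t)) 1≤j ≇K₂ ¬nontrivial
... | no  no-full = proper-ecc⇒competition G E proper
  where
  proper : Proper (ECC.cl E)
  proper t with ¬∀⟶∃¬ _ _ (λ v → ECC.cl E t v ≟ᵇ true) (λ full → no-full (t , full))
  ... | v , v∉ = v , ¬-not v∉

theorem2p7 : (G : Graph) (i j : ℕ) → 1 ≤ i → 1 ≤ j →
    IsIJCompetitionGraph i j G ⇔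
      ((¬ (G ≅ K 2)) × (j ≡ 1 → ¬ NontrivialComplete G) × ECC G i j)
theorem2p7 G i j _ 1≤j = mk⇔ (competition⇒conditions G i j) (conditions⇒competition G i j 1≤j)
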